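{- Let $n\ge0$ and $\sigma\in C_{2n}(123)$. The $y$-coordinate of the last point of the lattice path $\Phi(\sigma)$ equals twice the number of tiny minima of $\sigma$.
   Context: $C_{2n}(123)$ is the set of permutations $\sigma$ of $[2n]=\{1,\dots,2n\}$ with $\sigma(i)+\sigma(2n+1-i)=2n+1$ for all $i$ and no $i<j<k$ with $\sigma(i)<\sigma(j)<\sigma(k)$. A Dyck prefix of length $m$ is a word in $U=(1,1)$, $D=(1,-1)$ of length $m$ whose lattice path from the origin never goes below the $x$-axis. For a set $S=\{s_1<\dots<s_r\}$ and a permutation $\tau$ of $[r]$, the word on $S$ order-isomorphic to $\tau$ is $s_{\tau(1)}\cdots s_{\tau(r)}$. Define $\Psi$ recursively from Dyck prefixes of length $2n$ to permutations of $[2n]$: the empty prefix goes to the empty permutation; for nonempty $\pi=U^jD^k\pi'$ ($j\ge1,k\ge0$ maximal), $\sigma=\Psi(\pi)$ is: (a) if $j\le n$: $\sigma(1)=2n+1-j$, $\sigma(i)=2n+2-i$ ($2\le i\le k$), $\sigma(2n)=j$, $\sigma(2n-i)=i$ ($1\le i\le k-1$), and $\sigma(k+1)\cdots\sigma(2n-k)$ is the word on $[2n]\setminus\{1,\dots,k-1,j,2n+1-j,2n-k+2,\dots,2n\}$ order-isomorphic to $\Psi(U^{j-k}\pi')$; (b) if $j=n+1$: $\sigma(1)=n$, $\sigma(i)=2n+2-i$ ($2\le i\le k+1$), $\sigma(2n)=n+1$, $\sigma(2n-i)=i$ ($1\le i\le k$), and $\sigma(k+2)\cdots\sigma(2n-k-1)$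 is the word on $[2n]\setminus\{1,\dots,k,n,n+1,2n-k+1,\dots,2n\}$ order-isomorphic to $\Psi(U^{n-k-1}\pi')$; (c) if $j\ge n+2$: $\sigma(1)=n$, $\sigma(2n)=n+1$, and $\sigma(2)\cdots\sigma(2n-1)$ is the word on $[2n]\setminus\{n,n+1\}$ order-isomorphic to $\Psi(U^{j-2}D^k\pi')$. The paper shows $\Psi$ is a bijection onto $C_{2n}(123)$; $\Phi$ denotes its inverse. Tiny minima: let $w(\sigma)=\sigma(1)\cdots\sigma(n)=x_1w_1\cdots x_sw_s$, where $x_1,\dots,x_s$ are the values of the left-to-right minima of $\sigma$ (positions $i$ with $\sigma(i)\le\sigma(j)$ for all $j\le i$) among the first $n$ positions and $w_i$ is the possibly empty word between $x_i$ and $x_{i+1}$ (or the end). Let $A_0=[2n]$ and let $A_i$ be obtained from $A_{i-1}$ by removing $x_i$, $2n+1-x_i$, the entries of $w_i$ and their complements $2n+1-a$. For $A=\{s_1<\dots<s_{2h}\}$ put $m(A)=s_h$. The minimum $x_i$ is tiny if $x_i=m(A_{i-1})$. -}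

module Defs where

open import Data.Bool using (Bool; true; false; if_then_else_; not)
open import Data.Nat using (ℕ; zero; suc; _+_; _*_; _∸_; _≤_; _<_; _≤ᵇ_; _≡ᵇ_; ⌊_/2⌋)
open import Data.Integer using (ℤ; +_; _-_)
open import Data.List using (List; []; _∷_; _++_; map; length; upTo; reverse; replicate; take; filterᵇ)
open import Data.Bool.ListAction using (any)
open import Data.List.Relation.Binary.Permutation.Propositional using (_↭_)
open import Data.Product using (_×_; _,_; ∃-syntax)
open import Relation.Nullary using (¬_)
open import Relation.Binary.PropositionalEquality using (_≡_)

data Step : Set where
  U D : Step

#U #D : List Step → ℕ
#U []      = 0
#U (U ∷ s) = suc (#U s)
#U (D ∷ s) = #U s
#D []      = 0
#D (U ∷ s) = #D s
#D (D ∷ s) = suc (#D s)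

DyckPrefix : List Step → Set
DyckPrefix π = ∀ m → m ≤ length π → #D (take m π) ≤ #U (take m π)

height : List Step → ℤ
height π = + (#U π) - + (#D π)

-- 0-indexed lookup with default 0
nth : List ℕ → ℕ → ℕ
nth []       _       = 0
nth (x ∷ _)  zero    = x
nth (_ ∷ xs) (suc i) = nth xs i

-- [a .. b] (empty if b < a)
range : ℕ → ℕ → List ℕ
range a b = map (λ i → a + i) (upTo (suc b ∸ a))

elem : ℕ → List ℕ → Bool
elem x = any (x ≡ᵇ_)

without : ℕ → List ℕ → List ℕ
without N removed = filterᵇ (λ x → not (elem x removed)) (range 1 N)

-- word on the sorted set S order-isomorphic to τ (τ a permutation of [|S|])
embed : List ℕ → List ℕ → List ℕ
embed S τ = map (λ v → nth S (v ∸ 1)) τ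

lead : Step → List Step → ℕ × List Step
lead U (U ∷ s) with lead U s
... | (j , r) = (suc j , r)
lead D (D ∷ s) with lead D s
... | (j , r) = (suc j , r)
lead _ s = (0 , s)

-- The map Ψ (with a fuel argument; fuel suc n suffices for prefixes of
-- length 2n since the half-length strictly decreases in each recursive call)

psiF : ℕ → ℕ → List Step → List ℕ
psiF zero    n π  = []
psiF (suc f) n [] = []
psiF (suc f) n π@(_ ∷ _) with lead U π
... | (j , r1) with lead D r1
...   | (k , π') =
  if j ≤ᵇ n then caseA
  else if j ≡ᵇ suc n then caseB
  else caseC
  where
  N = 2 * n
  caseA : List ℕ
  caseA =
    ((suc N ∸ j) ∷ reverse (range (N + 2 ∸ k) N))
    ++ embed (without N (range 1 (k ∸ 1) ++ (j ∷ (suc N ∸ j) ∷ []) ++ range (N + 2 ∸ k) N))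
             (psiF f (n ∸ k) (replicate (j ∸ k) U ++ π'))
    ++ reverse (range 1 (k ∸ 1)) ++ (j ∷ [])
  caseB : List ℕ
  caseB =
    (n ∷ reverse (range (suc N ∸ k) N))
    ++ embed (without N (range 1 k ++ (n ∷ suc n ∷ []) ++ range (suc N ∸ k) N))
             (psiF f (n ∸ suc k) (replicate (n ∸ suc k) U ++ π'))
    ++ reverse (range 1 k) ++ (suc n ∷ [])
  caseC : List ℕ
  caseC =
    (n ∷ [])
    ++ embed (without N (n ∷ suc n ∷ []))
             (psiF f (n ∸ 1) (replicate (j ∸ 2) U ++ replicate k D ++ π'))
    ++ (suc n ∷ [])

Ψ : ℕ → List Step → List ℕ
Ψ n π = psiF (suc n) n π

-- C_{2n}(123): permutations of [2n] (as words σ(1)…σ(2n)), centrosymmetric,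
-- avoiding 123.  Positions are 0-indexed in nth.

record InC (n : ℕ) (σ : List ℕ) : Set where
  field
    perm     : σ ↭ range 1 (2 * n)
    centro   : ∀ i → i < 2 * n → nth σ i + nth σ (2 * n ∸ suc i) ≡ suc (2 * n)
    avoid123 : ¬ (∃[ i ] ∃[ j ] ∃[ k ] (i < j × j < k × k < 2 * n ×
                  nth σ i < nth σ j × nth σ j < nth σ k))

-- Scan w(σ) = σ(1)…σ(n); A is the current set A_{i-1}
-- (sorted), cm the current running minimum.  Each entry a (a left-to-right
-- minimum or an entry of some w_i) is removed from A together with 2n+1-a
-- after it has been processed, so when a left-to-right minimum x_i is met,
-- A = A_{i-1}.

-- m(A) = s_h for A = {s_1 < … < s_{2h}}
med : List ℕ → ℕ
med A = nth A (⌊ length A /2⌋ ∸ 1)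

tinyGo : ℕ → List ℕ → ℕ → List ℕ → ℕ
tinyGo N A cm [] = 0
tinyGo N A cm (a ∷ w) =
  if a ≤ᵇ cm
  then (if a ≡ᵇ med A then 1 else 0) + tinyGo N A' a w
  else tinyGo N A' cm w
  where
  A' = filterᵇ (λ x → not (elem x (a ∷ (suc N ∸ a) ∷ []))) A

tiny : ℕ → List ℕ → ℕ
tiny n σ = tinyGo (2 * n) (range 1 (2 * n)) (suc (2 * n)) (take n σ)

module Submission where

-- Theorem 7: for a Dyck prefix π of length 2n the final height of π is twice
-- the number of tiny minima of σ = Ψ(π).
--
-- The proof is an induction along the recursion of Ψ.  Write π = Uʲ Dᵏ π'.
-- In each of the three branches Ψ(π) has the shape
--     x₀ · (N, …, N+1-p) · S[τ] · (p, …, 1) · x₁,          N = 2n,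
-- where τ = Ψ(π̂) for a shorter Dyck prefix π̂, {x₀, x₁} = {u, N+1-u}, and S[τ]
-- is τ transported by the order isomorphism ι of [1, |τ|] onto the set S of
-- the remaining values, a union of three runs closed under x ↦ N+1-x (module
-- Frame).  The scan that defines tiny minima
--   * first meets x₀, which is tiny iff x₀ = n, i.e. in branches (b) and (c);
--   * skips N, …, N+1-p, after which its current set is exactly S;
--   * then runs on S[τ] exactly as on τ, since the scan commutes with every
--     order-preserving relabelling that respects complements (module
--     Relabel); this needs the first letter of τ to be small (first-bound).
-- So tiny(σ) = tiny(τ) in branch (a) and 1 + tiny(τ) in (b), (c), matching
-- the heights of π̂ = Uʲ⁻ᵏπ', Uⁿ⁻ᵏ⁻¹π', Uʲ⁻²Dᵏπ' respectively.

open import Defs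
open import Function using (_∘_; id)
open import Data.Bool using (Bool; true; false; if_then_else_; not; _∨_; T)
open import Data.Bool.Properties using (∨-comm; ∨-assoc; ∨-zeroʳ; ∨-identityʳ)
open import Data.Nat
open import Data.Nat.Properties
open import Data.Nat.Tactic.RingSolver using (solve-∀)
open import Data.List
  using (List; []; _∷_; _++_; map; length; reverse; replicate; take; filterᵇ; applyUpTo)
open import Data.List.Properties
  using (map-++; length-map; length-++; length-reverse; length-replicate; unfold-reverse;
         reverse-++; reverse-involutive; reverse-map; take-map; take-[]; map-cong-local;
         map-applyUpTo; ++-assoc; ++-identityʳ)
open import Data.List.Relation.Unary.All as All using (All; []; _∷_)
open import Data.List.Relation.Unary.All.Properties using (++⁺; take⁺; filter⁺; map⁺)
open import Data.List.Relation.Unary.AllPairs using (AllPairs; []; _∷_)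
open import Data.Product using (_×_; _,_; proj₁; proj₂; ∃)
open import Data.Sum using (_⊎_; inj₁; inj₂)
open import Data.Empty using (⊥; ⊥-elim)
open import Data.Unit using (tt)
open import Relation.Nullary using (¬_; yes; no)
open import Relation.Nullary.Decidable using (T?)
open import Relation.Binary.PropositionalEquality
open import Relation.Binary.Definitions using (tri<; tri≈; tri>)

≡true : ∀ {b} → T b → b ≡ true
≡true {true} _ = refl

≡false : ∀ {b} → ¬ T b → b ≡ false
≡false {true}  h = ⊥-elim (h tt)
≡false {false} _ = refl

≤ᵇ-true : ∀ {x y} → x ≤ y → (x ≤ᵇ y) ≡ true
≤ᵇ-true le = ≡true (≤⇒≤ᵇ le)

≤ᵇ-false : ∀ {x y} → y < x → (x ≤ᵇ y) ≡ false
≤ᵇ-false {x} {y} lt = ≡false (λ t → <⇒≱ lt (≤ᵇ⇒≤ x y t))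

≤ᵇ-sound : ∀ {x y} → (x ≤ᵇ y) ≡ true → x ≤ y
≤ᵇ-sound {x} {y} e = ≤ᵇ⇒≤ x y (subst T (sym e) tt)

≡ᵇ-true : ∀ {x y} → x ≡ y → (x ≡ᵇ y) ≡ true
≡ᵇ-true {x} e = ≡true (≡⇒≡ᵇ x _ e)

≡ᵇ-false : ∀ {x y} → x ≢ y → (x ≡ᵇ y) ≡ false
≡ᵇ-false {x} {y} ne = ≡false (λ t → ne (≡ᵇ⇒≡ x y t))

≡ᵇ-sound : ∀ {x y} → (x ≡ᵇ y) ≡ true → x ≡ y
≡ᵇ-sound {x} {y} e = ≡ᵇ⇒≡ x y (subst T (sym e) tt)

twice≤⇒0 : ∀ {m} → 2 * m ≤ m → m ≡ 0
twice≤⇒0 {zero}  _  = refl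
twice≤⇒0 {suc m} le = ⊥-elim (<⇒≱ (m<m+n (suc m) {suc m + 0} (s≤s z≤n)) le)

nth-map : ∀ (f : ℕ → ℕ) xs i → i < length xs → nth (map f xs) i ≡ f (nth xs i)
nth-map f (x ∷ xs) zero    _         = refl
nth-map f (x ∷ xs) (suc i) (s≤s lt) = nth-map f xs i lt

nth-All : ∀ {P : ℕ → Set} {xs} → All P xs → ∀ i → i < length xs → P (nth xs i)
nth-All (p ∷ _)  zero    _         = p
nth-All (_ ∷ ps) (suc i) (s≤s lt) = nth-All ps i lt

nth-++ˡ : ∀ xs ys i → i < length xs → nth (xs ++ ys) i ≡ nth xs i
nth-++ˡ (x ∷ xs) ys zero    _         = refl
nth-++ˡ (x ∷ xs) ys (suc i) (s≤s lt) = nth-++ˡ xs ys i lt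

nth-++ʳ : ∀ xs ys i → nth (xs ++ ys) (length xs + i) ≡ nth ys i
nth-++ʳ []       ys i = refl
nth-++ʳ (x ∷ xs) ys i = nth-++ʳ xs ys i

nth-reverse : ∀ xs i → i < length xs → nth (reverse xs) (length xs ∸ suc i) ≡ nth xs i
nth-reverse (x ∷ xs) zero _ rewrite unfold-reverse x xs =
  subst (λ m → nth (reverse xs ++ x ∷ []) m ≡ x)
        (trans (+-identityʳ _) (length-reverse xs)) (nth-++ʳ (reverse xs) (x ∷ []) 0)
nth-reverse (x ∷ xs) (suc i) (s≤s lt) rewrite unfold-reverse x xs =
  trans (nth-++ˡ (reverse xs) (x ∷ []) _
          (subst (length xs ∸ suc i <_) (sym (length-reverse xs)) (∸-monoʳ-< (s≤s z≤n) lt)))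
        (nth-reverse xs i lt)

nth-sorted : ∀ {xs} → AllPairs _<_ xs → ∀ {i j} → i < j → j < length xs → nth xs i < nth xs j
nth-sorted (x< ∷ _)  {zero}  {suc j} _          (s≤s lt) = nth-All x< j lt
nth-sorted (_ ∷ srt) {suc i} {suc j} (s≤s i<j) (s≤s lt) = nth-sorted srt i<j lt

take-++-prefix : ∀ (xs ys : List ℕ) m → take (length xs + m) (xs ++ ys) ≡ xs ++ take m ys
take-++-prefix []       ys m = refl
take-++-prefix (x ∷ xs) ys m = cong (x ∷_) (take-++-prefix xs ys m)

take-++-short : ∀ (xs ys : List ℕ) m → m ≤ length xs → take m (xs ++ ys) ≡ take m xs
take-++-short xs       ys zero    _         = refl
take-++-short (x ∷ xs) ys (suc m) (s≤s le) = cong (x ∷_) (take-++-short xs ys m le)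

take-head : ∀ m (x : ℕ) xs {t ts} → take m (x ∷ xs) ≡ t ∷ ts → t ≡ x
take-head (suc m) x xs refl = refl

All-reverse : ∀ {P : ℕ → Set} {xs} → All P xs → All P (reverse xs)
All-reverse {xs = []}     []       = []
All-reverse {xs = x ∷ xs} (p ∷ ps) rewrite unfold-reverse x xs = ++⁺ (All-reverse ps) (p ∷ [])

-- R s m is the run s, s+1, …, s+m-1 of consecutive integers; every interval
-- 'range a b' of Defs is a run, and the sets in the frame are unions of runs.
R : ℕ → ℕ → List ℕ
R s zero    = []
R s (suc m) = s ∷ R (suc s) m

range-R : ∀ a b → range a b ≡ R a (suc b ∸ a)
range-R a b = trans (map-applyUpTo id (λ i → a + i) (suc b ∸ a))
                    (upTo-R a (suc b ∸ a) (λ i → a + i) (λ _ → refl))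
  where
  upTo-R : ∀ s m (g : ℕ → ℕ) → (∀ i → g i ≡ s + i) → applyUpTo g m ≡ R s m
  upTo-R s zero    g e = refl
  upTo-R s (suc m) g e = cong₂ _∷_ (trans (e 0) (+-identityʳ s))
                                   (upTo-R (suc s) m (g ∘ suc) (λ i → trans (e (suc i)) (+-suc s i)))

range-empty : ∀ b → range (suc b) b ≡ []
range-empty b rewrite range-R (suc b) b | n∸n≡0 b = refl

length-R : ∀ s m → length (R s m) ≡ m
length-R s zero    = refl
length-R s (suc m) = cong suc (length-R (suc s) m)

R-++ : ∀ s m₁ m₂ → R s (m₁ + m₂) ≡ R s m₁ ++ R (s + m₁) m₂
R-++ s zero     m₂ = cong (λ t → R t m₂) (sym (+-identityʳ s))
R-++ s (suc m₁) m₂ =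
  cong (s ∷_) (trans (R-++ (suc s) m₁ m₂) (cong (λ t → R (suc s) m₁ ++ R t m₂) (sym (+-suc s m₁))))

nth-R : ∀ s m i → i < m → nth (R s m) i ≡ s + i
nth-R s (suc m) zero    _         = sym (+-identityʳ s)
nth-R s (suc m) (suc i) (s≤s lt) = trans (nth-R (suc s) m i lt) (sym (+-suc s i))

R-bounds : ∀ s m → All (λ x → s ≤ x × x < s + m) (R s m)
R-bounds s zero    = []
R-bounds s (suc m) =
  (≤-refl , m<m+n s (s≤s z≤n)) ∷
  All.map (λ {x} (l , r) → ≤-trans (n≤1+n s) l , subst (x <_) (sym (+-suc s m)) r) (R-bounds (suc s) m)

All-R : ∀ {P : ℕ → Set} s m → (∀ {x} → s ≤ x → x < s + m → P x) → All P (R s m)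
All-R s m h = All.map (λ (l , r) → h l r) (R-bounds s m)

map-nth-R : ∀ xs s → map (λ v → nth xs (v ∸ s)) (R s (length xs)) ≡ xs
map-nth-R []       s = refl
map-nth-R (x ∷ xs) s = cong₂ _∷_ (cong (nth (x ∷ xs)) (n∸n≡0 s))
  (trans (map-cong-local (All-R (suc s) (length xs) λ {v} s<v _ → cong (nth (x ∷ xs)) (shift v s s<v)))
         (map-nth-R xs (suc s)))
  where
  shift : ∀ v s → suc s ≤ v → v ∸ s ≡ suc (v ∸ suc s)
  shift (suc v) zero    _         = refl
  shift (suc v) (suc s) (s≤s le) = shift v s le

sorted-R++ : ∀ s m xs → All (s + m ≤_) xs → AllPairs _<_ xs → AllPairs _<_ (R s m ++ xs)
sorted-R++ s zero    xs big srt = srt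
sorted-R++ s (suc m) xs big srt =
  ++⁺ (All-R (suc s) m (λ l _ → l)) (All.map (<-≤-trans (m<m+n s (s≤s z≤n))) big)
  ∷ sorted-R++ (suc s) m xs (All.map (≤-trans (≤-reflexive (sym (+-suc s m)))) big) srt

map-∸-R : ∀ K s m s' → s' + m + s ≡ suc K → map (K ∸_) (R s m) ≡ reverse (R s' m)
map-∸-R K s zero    s' e = refl
map-∸-R K s (suc m) s' e = begin
    (K ∸ s) ∷ map (K ∸_) (R (suc s) m)
  ≡⟨ cong₂ _∷_ K∸s (map-∸-R K (suc s) m s' (trans (shift s' m s) e)) ⟩
    (s' + m) ∷ reverse (R s' m)
  ≡⟨ sym (reverse-++ (R s' m) (s' + m ∷ [])) ⟩
    reverse (R s' m ++ (s' + m ∷ []))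
  ≡⟨ cong reverse (sym (trans (cong (R s') (+-comm 1 m)) (R-++ s' m 1))) ⟩
    reverse (R s' (suc m)) ∎
  where
  open ≡-Reasoning
  shift : ∀ s' m s → s' + m + suc s ≡ s' + suc m + s
  shift = solve-∀
  K∸s : K ∸ s ≡ s' + m
  K∸s = trans (cong (_∸ s) (suc-injective (trans (sym e) (unfold s' m s)))) (m+n∸n≡m (s' + m) s)
    where
    unfold : ∀ s' m s → s' + suc m + s ≡ suc (s' + m + s)
    unfold = solve-∀

elem-++ : ∀ x xs ys → elem x (xs ++ ys) ≡ elem x xs ∨ elem x ys
elem-++ x []       ys = refl
elem-++ x (y ∷ xs) ys = trans (cong ((x ≡ᵇ y) ∨_) (elem-++ x xs ys)) (sym (∨-assoc (x ≡ᵇ y) _ _))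

elem-reverse : ∀ x xs → elem x (reverse xs) ≡ elem x xs
elem-reverse x []       = refl
elem-reverse x (y ∷ xs) rewrite unfold-reverse y xs | elem-++ x (reverse xs) (y ∷ [])
  | elem-reverse x xs | ∨-identityʳ (x ≡ᵇ y) = ∨-comm (elem x xs) (x ≡ᵇ y)

elem-swap : ∀ x y z → elem x (y ∷ z ∷ []) ≡ elem x (z ∷ y ∷ [])
elem-swap x y z rewrite ∨-identityʳ (x ≡ᵇ y) | ∨-identityʳ (x ≡ᵇ z) = ∨-comm (x ≡ᵇ y) (x ≡ᵇ z)

elem-R-in : ∀ x s m → s ≤ x → x < s + m → elem x (R s m) ≡ true
elem-R-in x s zero    le lt = ⊥-elim (<⇒≱ lt (subst (_≤ x) (sym (+-identityʳ s)) le))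
elem-R-in x s (suc m) le lt with x ≟ s
... | yes refl rewrite ≡ᵇ-true {x} refl = refl
... | no  x≢s  rewrite ≡ᵇ-false x≢s =
  elem-R-in x (suc s) m (≤∧≢⇒< le (x≢s ∘ sym)) (subst (x <_) (+-suc s m) lt)

elem-R-out : ∀ x s m → x < s ⊎ s + m ≤ x → elem x (R s m) ≡ false
elem-R-out x s zero    _ = refl
elem-R-out x s (suc m) (inj₁ lt) rewrite ≡ᵇ-false (<⇒≢ lt) =
  elem-R-out x (suc s) m (inj₁ (≤-trans lt (n≤1+n s)))
elem-R-out x s (suc m) (inj₂ le)
  rewrite ≡ᵇ-false {x} {s} (λ e → <⇒≢ (<-≤-trans (m<m+n s (s≤s z≤n)) le) (sym e)) =
  elem-R-out x (suc s) m (inj₂ (subst (_≤ x) (+-suc s m) le))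

-- remove X A: the elements of A that do not occur in X.  This is the update
-- of the current set in Defs' scan, and 'without N X = remove X (range 1 N)'.
remove : List ℕ → List ℕ → List ℕ
remove X = filterᵇ (λ x → not (elem x X))

remove-[] : ∀ A → remove [] A ≡ A
remove-[] []      = refl
remove-[] (a ∷ A) = cong (a ∷_) (remove-[] A)

remove-remove : ∀ X Y A → remove Y (remove X A) ≡ remove (X ++ Y) A
remove-remove X Y []      = refl
remove-remove X Y (a ∷ A) rewrite elem-++ a X Y with elem a X
... | true  = remove-remove X Y A
... | false with elem a Y
...   | true  = remove-remove X Y A
...   | false = cong (a ∷_) (remove-remove X Y A)

remove-cong : ∀ {X Y} → (∀ x → elem x X ≡ elem x Y) → ∀ A → remove X A ≡ remove Y A
remove-cong eq []      = refl
remove-cong {X} {Y} eq (a ∷ A) rewrite eq a with elem a Y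
... | true  = remove-cong {X} {Y} eq A
... | false = cong (a ∷_) (remove-cong {X} {Y} eq A)

filterᵇ-keep : ∀ (Q : ℕ → Bool) ys xs → All (λ x → Q x ≡ true) ys →
  filterᵇ Q (ys ++ xs) ≡ ys ++ filterᵇ Q xs
filterᵇ-keep Q []       xs []       = refl
filterᵇ-keep Q (y ∷ ys) xs (e ∷ es) rewrite e = cong (y ∷_) (filterᵇ-keep Q ys xs es)

filterᵇ-none : ∀ (Q : ℕ → Bool) ys → All (λ x → Q x ≡ false) ys → filterᵇ Q ys ≡ []
filterᵇ-none Q []       []       = refl
filterᵇ-none Q (y ∷ ys) (e ∷ es) rewrite e = filterᵇ-none Q ys es

filterᵇ-drop : ∀ (Q : ℕ → Bool) ys xs → All (λ x → Q x ≡ false) ys →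
  filterᵇ Q (ys ++ xs) ≡ filterᵇ Q xs
filterᵇ-drop Q []       xs []       = refl
filterᵇ-drop Q (y ∷ ys) xs (e ∷ es) rewrite e = filterᵇ-drop Q ys xs es

InRange : ℕ → ℕ → Set
InRange N x = 1 ≤ x × x ≤ N

Word : ℕ → List ℕ → Set
Word n σ = length σ ≡ 2 * n × All (InRange (2 * n)) σ

FirstAtMost : ℕ → ℕ → List ℕ → Set
FirstAtMost b m τ = ∀ t ts → take m τ ≡ t ∷ ts → t ≤ b

-- The entries y₁, N+1-y₁, y₂, N+1-y₂, … removed together with the entries yᵢ.
pairs : ℕ → List ℕ → List ℕ
pairs N []       = []
pairs N (y ∷ ys) = y ∷ suc N ∸ y ∷ pairs N ys

elem-pairs : ∀ N x ys → elem x (pairs N ys) ≡ elem x ys ∨ elem x (map (suc N ∸_) ys)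
elem-pairs N x []       = refl
elem-pairs N x (y ∷ ys) rewrite elem-pairs N x ys with x ≡ᵇ y | x ≡ᵇ (suc N ∸ y)
... | true  | _     = refl
... | false | true  = sym (∨-zeroʳ (elem x ys))
... | false | false = refl

-- Entries above the current minimum are not minima: the scan only removes
-- them, with their complements, from the current set.
tiny-skip : ∀ N A c ys w → All (c <_) ys →
  tinyGo N A c (ys ++ w) ≡ tinyGo N (remove (pairs N ys) A) c w
tiny-skip N A c []       w []         = cong (λ B → tinyGo N B c w) (sym (remove-[] A))
tiny-skip N A c (y ∷ ys) w (c<y ∷ cs) rewrite ≤ᵇ-false c<y =
  trans (tiny-skip N _ c ys w cs)
        (cong (λ B → tinyGo N B c w) (remove-remove (y ∷ suc N ∸ y ∷ []) (pairs N ys) A))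

med-range : ∀ m → med (range 1 (2 * suc m)) ≡ suc m
med-range m = begin
    nth (range 1 N) (⌊ length (range 1 N) /2⌋ ∸ 1)
  ≡⟨ cong (λ A → nth A (⌊ length A /2⌋ ∸ 1)) (range-R 1 N) ⟩
    nth (R 1 N) (⌊ length (R 1 N) /2⌋ ∸ 1)
  ≡⟨ cong (λ l → nth (R 1 N) (⌊ l /2⌋ ∸ 1)) (length-R 1 N) ⟩
    nth (R 1 N) (⌊ N /2⌋ ∸ 1)
  ≡⟨ cong (λ k → nth (R 1 N) (⌊ suc m + k /2⌋ ∸ 1)) (+-identityʳ (suc m)) ⟩
    nth (R 1 N) (⌊ suc m + suc m /2⌋ ∸ 1)
  ≡⟨ cong (λ k → nth (R 1 N) (k ∸ 1)) (sym (n≡⌊n+n/2⌋ (suc m))) ⟩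
    nth (R 1 N) m
  ≡⟨ nth-R 1 N m (s≤s (m≤m+n m _)) ⟩
    suc m ∎
  where
  open ≡-Reasoning
  N = 2 * suc m

-- The scan is invariant under an order-preserving relabelling f of [1, N']
-- into [1, N] that maps complements (x ↦ N'+1-x) to complements (y ↦ N+1-y).
module Relabel (N N' : ℕ) (f : ℕ → ℕ)
  (f-mono : ∀ {x y} → InRange N' x → InRange N' y → x < y → f x < f y)
  (f-comp : ∀ {x} → InRange N' x → f (suc N' ∸ x) ≡ suc N ∸ f x)
  (f-pos  : ∀ {x} → InRange N' x → 1 ≤ f x) where

  private
    Dom : ℕ → Set
    Dom = InRange N'

    ≤ᵇ-map : ∀ {x y} → Dom x → Dom y → (f x ≤ᵇ f y) ≡ (x ≤ᵇ y)
    ≤ᵇ-map {x} {y} dx dy with <-cmp x y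
    ... | tri< x<y _ _  = trans (≤ᵇ-true (<⇒≤ (f-mono dx dy x<y))) (sym (≤ᵇ-true (<⇒≤ x<y)))
    ... | tri≈ _ refl _ = trans (≤ᵇ-true (≤-refl {f x})) (sym (≤ᵇ-true (≤-refl {x})))
    ... | tri> _ _ y<x  = trans (≤ᵇ-false (f-mono dy dx y<x)) (sym (≤ᵇ-false y<x))

    ≡ᵇ-map : ∀ {x y} → Dom x → Dom y → (f x ≡ᵇ f y) ≡ (x ≡ᵇ y)
    ≡ᵇ-map {x} {y} dx dy with <-cmp x y
    ... | tri< x<y _ _  = trans (≡ᵇ-false (<⇒≢ (f-mono dx dy x<y))) (sym (≡ᵇ-false (<⇒≢ x<y)))
    ... | tri≈ _ refl _ = trans (≡ᵇ-true {f x} refl) (sym (≡ᵇ-true {x} refl))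
    ... | tri> _ _ y<x  =
      trans (≡ᵇ-false (≢-sym (<⇒≢ (f-mono dy dx y<x)))) (sym (≡ᵇ-false (≢-sym (<⇒≢ y<x))))

    comp-in : ∀ {x} → Dom x → Dom (suc N' ∸ x)
    comp-in {suc x} (_ , x<N') = m<n⇒0<n∸m x<N' , m∸n≤m N' x

    elem-map : ∀ {x} X → Dom x → All Dom X → elem (f x) (map f X) ≡ elem x X
    elem-map []      dx []         = refl
    elem-map (y ∷ X) dx (dy ∷ dX) = cong₂ _∨_ (≡ᵇ-map dx dy) (elem-map X dx dX)

    remove-map : ∀ {X} A → All Dom X → All Dom A → remove (map f X) (map f A) ≡ map f (remove X A)
    remove-map []      dX []         = refl
    remove-map {X} (x ∷ A) dX (dx ∷ dA) rewrite elem-map X dx dX with elem x X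
    ... | true  = remove-map A dX dA
    ... | false = cong (f x ∷_) (remove-map A dX dA)

    remove-step : ∀ {t} A → Dom t → All Dom A →
      remove (f t ∷ suc N ∸ f t ∷ []) (map f A) ≡ map f (remove (t ∷ suc N' ∸ t ∷ []) A)
    remove-step {t} A dt dA =
      trans (cong (λ y → remove (f t ∷ y ∷ []) (map f A)) (sym (f-comp dt)))
            (remove-map A (dt ∷ comp-in dt ∷ []) dA)

    All-remove : ∀ X {A} → All Dom A → All Dom (remove X A)
    All-remove X = filter⁺ (λ x → T? (not (elem x X)))

    med-index : ∀ (a : ℕ) A → ⌊ length (a ∷ A) /2⌋ ∸ 1 < length (a ∷ A)
    med-index _ A = s≤s (∸-monoˡ-≤ 1 (⌊n/2⌋≤n (suc (length A))))

    med-map : ∀ {v} A → Dom v → All Dom A → (f v ≡ᵇ med (map f A)) ≡ (v ≡ᵇ med A)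
    med-map []          dv [] =
      trans (≡ᵇ-false (≢-sym (<⇒≢ (f-pos dv)))) (sym (≡ᵇ-false (≢-sym (<⇒≢ (proj₁ dv)))))
    med-map (a ∷ A) dv dA
      rewrite length-map f A | nth-map f (a ∷ A) (⌊ length (a ∷ A) /2⌋ ∸ 1) (med-index a A)
      = ≡ᵇ-map dv (nth-All dA _ (med-index a A))

  mutual
    relabel : ∀ A v w → All Dom A → Dom v → All Dom w →
      tinyGo N (map f A) (f v) (map f w) ≡ tinyGo N' A v w
    relabel A v []       dA dv []         = refl
    relabel A v (t ∷ ts) dA dv (dt ∷ dts) rewrite ≤ᵇ-map dt dv with t ≤ᵇ v
    ... | true  = picked A t ts dA dt dts
    ... | false = trans (cong (λ B → tinyGo N B (f v) (map f ts)) (remove-step A dt dA))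
                        (relabel _ v ts (All-remove (t ∷ suc N' ∸ t ∷ []) dA) dv dts)

    picked : ∀ A t ts → All Dom A → Dom t → All Dom ts →
      (if f t ≡ᵇ med (map f A) then 1 else 0)
        + tinyGo N (remove (f t ∷ suc N ∸ f t ∷ []) (map f A)) (f t) (map f ts)
      ≡ (if t ≡ᵇ med A then 1 else 0) + tinyGo N' (remove (t ∷ suc N' ∸ t ∷ []) A) t ts
    picked A t ts dA dt dts rewrite med-map A dt dA =
      cong (λ k → (if t ≡ᵇ med A then 1 else 0) + k)
           (trans (cong (λ B → tinyGo N B (f t) (map f ts)) (remove-step A dt dA))
                  (relabel _ t ts (All-remove (t ∷ suc N' ∸ t ∷ []) dA) dt dts))

  relabel-head : ∀ A c c' t ts → All Dom A → Dom t → All Dom ts → f t ≤ c → t ≤ c' →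
    tinyGo N (map f A) c (map f (t ∷ ts)) ≡ tinyGo N' A c' (t ∷ ts)
  relabel-head A c c' t ts dA dt dts ft≤c t≤c' rewrite ≤ᵇ-true ft≤c | ≤ᵇ-true t≤c' =
    picked A t ts dA dt dts

-- The frame common to the three branches of Ψ

-- For parameters p, L, h put u = p+L+1, n = h+u, N = 2n and n' = h+L.
-- Each branch of Ψ removes Rm = [1,p] ∪ {u, N+1-u} ∪ [N+1-p, N] and writes
-- the recursive word on S = [1,N] ∖ Rm, which is the union E of three runs
--   [p+1, u-1],  [u+1, N-u],  [N+2-u, N+1-u+L]
-- of sizes L, 2h, L.  S is closed under x ↦ N+1-x and |S| = 2n'.
module Frame (p L h : ℕ) where

  -- a, c, d start the three runs; u and u' = N+1-u are the removed values between them
  a u c M u' d n N n' : ℕ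
  a  = suc p
  u  = a + L
  c  = suc u
  M  = h + h
  u' = M + c
  d  = suc u'
  n  = h + u
  N  = 2 * n
  n' = h + L

  low high Rm S E : List ℕ
  low  = range 1 p
  high = range (suc N ∸ p) N
  Rm   = low ++ (u ∷ u' ∷ []) ++ high
  S    = without N Rm
  E    = R a L ++ R c M ++ R d L

  private
    top : d + L + p ≡ suc N
    top = eq p L h
      where
      eq : ∀ p L h → suc (h + h + suc (suc (p + L))) + L + p ≡ suc (2 * (h + suc (p + L)))
      eq = solve-∀

    u+u' : u + u' ≡ suc N
    u+u' = eq p L h
      where
      eq : ∀ p L h → suc (p + L) + (h + h + suc (suc (p + L))) ≡ suc (2 * (h + suc (p + L)))
      eq = solve-∀

    N-runs : N ≡ p + (L + suc (M + suc (L + p)))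
    N-runs = eq p L h
      where
      eq : ∀ p L h → 2 * (h + suc (p + L)) ≡ p + (L + suc (h + h + suc (L + p)))
      eq = solve-∀

    n-split : n ≡ suc (p + n')
    n-split = eq p L h
      where
      eq : ∀ p L h → h + suc (p + L) ≡ suc (p + (h + L))
      eq = solve-∀

    runs-size : L + (M + L) ≡ 2 * n'
    runs-size = eq L h
      where
      eq : ∀ L h → L + (h + h + L) ≡ 2 * (h + L)
      eq = solve-∀

    length-assembled : suc (p + (2 * n' + (p + 1))) ≡ N
    length-assembled = eq p L h
      where
      eq : ∀ p L h → suc (p + (2 * (h + L) + (p + 1))) ≡ 2 * (h + suc (p + L))
      eq = solve-∀

    -- the three runs of E are mapped onto one another by x ↦ N+1-x
    mirror-low : d + L + a ≡ suc (suc N)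
    mirror-low = trans (+-suc (d + L) p) (cong suc top)

    mirror-mid : c + M + c ≡ suc (suc N)
    mirror-mid = eq p L h
      where
      eq : ∀ p L h → suc (suc (p + L)) + (h + h) + suc (suc (p + L)) ≡ suc (suc (2 * (h + suc (p + L))))
      eq = solve-∀

    mirror-up : a + L + d ≡ suc (suc N)
    mirror-up = eq p L h
      where
      eq : ∀ p L h → suc p + L + suc (h + h + suc (suc (p + L))) ≡ suc (suc (2 * (h + suc (p + L))))
      eq = solve-∀

    c+M : c + M ≡ u'
    c+M = +-comm c M

    high-start : suc N ∸ p ≡ d + L
    high-start = trans (cong (_∸ p) (sym top)) (m+n∸n≡m (d + L) p)

    p<u : p < u
    p<u = s≤s (m≤m+n p L)

    u<u' : u < u'
    u<u' = m≤n+m c M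

    n<u' : n < u'
    n<u' = subst (n <_) (sym (+-assoc h h c)) (+-monoʳ-< h (m≤n+m c h))

    u'<d : u' < d
    u'<d = ≤-refl

    u'<d+L : u' < d + L
    u'<d+L = <-≤-trans u'<d (m≤m+n d L)

    u<d+L : u < d + L
    u<d+L = <-trans u<u' u'<d+L

    d+L≤sN : d + L ≤ suc N
    d+L≤sN = subst (d + L ≤_) top (m≤m+n (d + L) p)

    below-top : ∀ {x} → 1 ≤ x → x < d + L → InRange N x
    below-top 1≤x x< = 1≤x , ≤-pred (≤-trans x< d+L≤sN)

  comp-u : suc N ∸ u ≡ u'
  comp-u = trans (cong (_∸ u) (sym u+u')) (m+n∸m≡n u u')

  comp-u' : suc N ∸ u' ≡ u
  comp-u' = trans (cong (_∸ u') (sym u+u')) (m+n∸n≡m u u')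

  low-R : low ≡ R 1 p
  low-R = range-R 1 p

  high-R : high ≡ R (d + L) p
  high-R = trans (range-R (suc N ∸ p) N)
                 (cong₂ R high-start (trans (cong (suc N ∸_) high-start)
                                            (trans (cong (_∸ (d + L)) (sym top)) (m+n∸m≡n (d + L) p))))

  complement-high : map (suc N ∸_) high ≡ reverse low
  complement-high rewrite high-R | low-R =
    map-∸-R (suc N) (d + L) p 1 (cong suc (trans (+-comm p (d + L)) top))

  elem-Rm : ∀ x → elem x Rm ≡ elem x low ∨ ((x ≡ᵇ u) ∨ ((x ≡ᵇ u') ∨ elem x high))
  elem-Rm x = elem-++ x low _

  -- Scanning x₀, N+1-x₀ and then the block N, …, N+1-p (with complements)
  -- removes exactly Rm, provided {x₀, N+1-x₀} = {u, N+1-u}.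
  removed-set : ∀ x₀ → (∀ x → elem x (x₀ ∷ suc N ∸ x₀ ∷ []) ≡ elem x (u ∷ u' ∷ [])) →
    ∀ x → elem x ((x₀ ∷ suc N ∸ x₀ ∷ []) ++ pairs N (reverse high)) ≡ elem x Rm
  removed-set x₀ pair x = begin
      elem x ((x₀ ∷ suc N ∸ x₀ ∷ []) ++ pairs N (reverse high))
    ≡⟨ elem-++ x (x₀ ∷ suc N ∸ x₀ ∷ []) (pairs N (reverse high)) ⟩
      elem x (x₀ ∷ suc N ∸ x₀ ∷ []) ∨ elem x (pairs N (reverse high))
    ≡⟨ cong₂ _∨_ (pair x) (elem-pairs N x (reverse high)) ⟩
      P ∨ (elem x (reverse high) ∨ elem x (map (suc N ∸_) (reverse high)))
    ≡⟨ cong (λ b → P ∨ (b ∨ elem x (map (suc N ∸_) (reverse high)))) (elem-reverse x high) ⟩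
      P ∨ (elem x high ∨ elem x (map (suc N ∸_) (reverse high)))
    ≡⟨ cong (λ b → P ∨ (elem x high ∨ b)) complements ⟩
      P ∨ (elem x high ∨ elem x low)
    ≡⟨ sym (∨-assoc P (elem x high) (elem x low)) ⟩
      (P ∨ elem x high) ∨ elem x low
    ≡⟨ ∨-comm (P ∨ elem x high) (elem x low) ⟩
      elem x low ∨ (P ∨ elem x high)
    ≡⟨ cong (elem x low ∨_) (sym (elem-++ x (u ∷ u' ∷ []) high)) ⟩
      elem x low ∨ elem x ((u ∷ u' ∷ []) ++ high)
    ≡⟨ sym (elem-++ x low _) ⟩
      elem x Rm ∎
    where
    open ≡-Reasoning
    P = elem x (u ∷ u' ∷ [])
    complements : elem x (map (suc N ∸_) (reverse high)) ≡ elem x low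
    complements = begin
        elem x (map (suc N ∸_) (reverse high))
      ≡⟨ cong (elem x) (reverse-map (suc N ∸_) high) ⟩
        elem x (reverse (map (suc N ∸_) high))
      ≡⟨ elem-reverse x (map (suc N ∸_) high) ⟩
        elem x (map (suc N ∸_) high)
      ≡⟨ cong (elem x) complement-high ⟩
        elem x (reverse low)
      ≡⟨ elem-reverse x low ⟩
        elem x low ∎

  private
    Q : ℕ → Bool
    Q x = not (elem x Rm)

    Q-kept : ∀ {x} → p < x → x ≢ u → x ≢ u' → x < d + L → Q x ≡ true
    Q-kept {x} p<x x≢u x≢u' x<
      rewrite elem-Rm x
            | trans (cong (elem x) low-R) (elem-R-out x 1 p (inj₂ p<x))
            | ≡ᵇ-false x≢u | ≡ᵇ-false x≢u'
            | trans (cong (elem x) high-R) (elem-R-out x (d + L) p (inj₁ x<)) = refl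

    Q-low : ∀ {x} → 1 ≤ x → x < 1 + p → Q x ≡ false
    Q-low {x} 1≤x x< rewrite elem-Rm x | trans (cong (elem x) low-R) (elem-R-in x 1 p 1≤x x<) = refl

    Q-high : ∀ {x} → d + L ≤ x → x < d + L + p → Q x ≡ false
    Q-high {x} le x<
      rewrite elem-Rm x | trans (cong (elem x) high-R) (elem-R-in x (d + L) p le x<)
            | ∨-zeroʳ (x ≡ᵇ u') | ∨-zeroʳ (x ≡ᵇ u) | ∨-zeroʳ (elem x low) = refl

    Q-u : Q u ≡ false
    Q-u rewrite elem-Rm u | ≡ᵇ-true {u} refl | ∨-zeroʳ (elem u low) = refl

    Q-u' : Q u' ≡ false
    Q-u' rewrite elem-Rm u' | ≡ᵇ-true {u'} refl | ∨-zeroʳ (u' ≡ᵇ u) | ∨-zeroʳ (elem u' low) = refl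

    R-1N : R 1 N ≡ R 1 p ++ R a L ++ u ∷ R c M ++ u' ∷ R d L ++ R (d + L) p
    R-1N = begin
        R 1 N
      ≡⟨ cong (R 1) N-runs ⟩
        R 1 (p + (L + suc (M + suc (L + p))))
      ≡⟨ R-++ 1 p _ ⟩
        R 1 p ++ R a (L + suc (M + suc (L + p)))
      ≡⟨ cong (R 1 p ++_) (R-++ a L _) ⟩
        R 1 p ++ R a L ++ u ∷ R c (M + suc (L + p))
      ≡⟨ cong (λ z → R 1 p ++ R a L ++ u ∷ z) (R-++ c M _) ⟩
        R 1 p ++ R a L ++ u ∷ R c M ++ R (c + M) (suc (L + p))
      ≡⟨ cong (λ z → R 1 p ++ R a L ++ u ∷ R c M ++ R z (suc (L + p))) c+M ⟩
        R 1 p ++ R a L ++ u ∷ R c M ++ u' ∷ R d (L + p)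
      ≡⟨ cong (λ z → R 1 p ++ R a L ++ u ∷ R c M ++ u' ∷ z) (R-++ d L p) ⟩
        R 1 p ++ R a L ++ u ∷ R c M ++ u' ∷ R d L ++ R (d + L) p ∎
      where open ≡-Reasoning

  S≡E : S ≡ E
  S≡E = begin
      remove Rm (range 1 N)
    ≡⟨ cong (remove Rm) (range-R 1 N) ⟩
      filterᵇ Q (R 1 N)
    ≡⟨ cong (filterᵇ Q) R-1N ⟩
      filterᵇ Q (R 1 p ++ R a L ++ u ∷ R c M ++ u' ∷ R d L ++ R (d + L) p)
    ≡⟨ filterᵇ-drop Q (R 1 p) _ (All-R 1 p Q-low) ⟩
      filterᵇ Q (R a L ++ u ∷ R c M ++ u' ∷ R d L ++ R (d + L) p)
    ≡⟨ filterᵇ-keep Q (R a L) _ (All-R a L λ a≤x x<u →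
         Q-kept (<-≤-trans ≤-refl a≤x) (<⇒≢ x<u) (<⇒≢ (<-trans x<u u<u')) (<-trans x<u (u<d+L))) ⟩
      R a L ++ filterᵇ Q (u ∷ R c M ++ u' ∷ R d L ++ R (d + L) p)
    ≡⟨ cong (R a L ++_) (filterᵇ-drop Q (u ∷ []) _ (Q-u ∷ [])) ⟩
      R a L ++ filterᵇ Q (R c M ++ u' ∷ R d L ++ R (d + L) p)
    ≡⟨ cong (R a L ++_) (filterᵇ-keep Q (R c M) _ (All-R c M λ {x} c≤x x< →
         let x<u' = subst (x <_) c+M x< in
         Q-kept (<-trans p<u (<-≤-trans ≤-refl c≤x)) (≢-sym (<⇒≢ c≤x)) (<⇒≢ x<u')
                (<-trans x<u' u'<d+L))) ⟩
      R a L ++ R c M ++ filterᵇ Q (u' ∷ R d L ++ R (d + L) p)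
    ≡⟨ cong (λ z → R a L ++ R c M ++ z) (filterᵇ-drop Q (u' ∷ []) _ (Q-u' ∷ [])) ⟩
      R a L ++ R c M ++ filterᵇ Q (R d L ++ R (d + L) p)
    ≡⟨ cong (λ z → R a L ++ R c M ++ z) (filterᵇ-keep Q (R d L) _ (All-R d L λ d≤x x< →
         let u'<x = <-≤-trans u'<d d≤x in
         Q-kept (<-trans p<u (<-trans u<u' u'<x)) (≢-sym (<⇒≢ (<-trans u<u' u'<x))) (≢-sym (<⇒≢ u'<x)) x<)) ⟩
      R a L ++ R c M ++ R d L ++ filterᵇ Q (R (d + L) p)
    ≡⟨ cong (λ z → R a L ++ R c M ++ R d L ++ z) (filterᵇ-none Q (R (d + L) p) (All-R (d + L) p Q-high)) ⟩
      R a L ++ R c M ++ R d L ++ []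
    ≡⟨ cong (λ z → R a L ++ R c M ++ z) (++-identityʳ (R d L)) ⟩
      E ∎
    where open ≡-Reasoning

  E-sorted : AllPairs _<_ E
  E-sorted =
    sorted-R++ a L _ (++⁺ (All-R c M λ c≤x _ → ≤-trans (n≤1+n u) c≤x)
                          (All-R d L λ d≤x _ → ≤-trans (<⇒≤ (<-trans u<u' u'<d)) d≤x))
      (sorted-R++ c M _ (All-R d L λ d≤x _ → ≤-trans (≤-trans (≤-reflexive c+M) (n≤1+n u')) d≤x)
        (subst (AllPairs _<_) (++-identityʳ (R d L)) (sorted-R++ d L [] [] [])))

  E-in : All (InRange N) E
  E-in = ++⁺ (All-R a L λ a≤x x<u → below-top (≤-trans (s≤s z≤n) a≤x) (<-trans x<u u<d+L))
        (++⁺ (All-R c M λ {x} c≤x x< → below-top (≤-trans (s≤s z≤n) c≤x)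
                                          (<-trans (subst (x <_) c+M x<) u'<d+L))
             (All-R d L λ d≤x x< → below-top (≤-trans (s≤s z≤n) d≤x) x<))

  E-below : All (_< u') (R a L ++ R c M)
  E-below = ++⁺ (All-R a L λ _ x<u → <-trans x<u u<u')
                (All-R c M λ {x} _ x< → subst (x <_) c+M x<)

  E-symmetric : reverse (map (suc N ∸_) E) ≡ E
  E-symmetric = begin
      reverse (map κ (R a L ++ R c M ++ R d L))
    ≡⟨ cong reverse (trans (map-++ κ (R a L) _) (cong (map κ (R a L) ++_) (map-++ κ (R c M) (R d L)))) ⟩
      reverse (map κ (R a L) ++ map κ (R c M) ++ map κ (R d L))
    ≡⟨ cong reverse (cong₂ _++_ (map-∸-R (suc N) a L d mirror-low)
                       (cong₂ _++_ (map-∸-R (suc N) c M c mirror-mid) (map-∸-R (suc N) d L a mirror-up))) ⟩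
      reverse (reverse (R d L) ++ reverse (R c M) ++ reverse (R a L))
    ≡⟨ cong reverse (cong (reverse (R d L) ++_) (sym (reverse-++ (R a L) (R c M)))) ⟩
      reverse (reverse (R d L) ++ reverse (R a L ++ R c M))
    ≡⟨ cong reverse (sym (reverse-++ (R a L ++ R c M) (R d L))) ⟩
      reverse (reverse ((R a L ++ R c M) ++ R d L))
    ≡⟨ reverse-involutive _ ⟩
      (R a L ++ R c M) ++ R d L
    ≡⟨ ++-assoc (R a L) (R c M) (R d L) ⟩
      E ∎
    where
    open ≡-Reasoning
    κ : ℕ → ℕ
    κ = suc N ∸_

  length-E : length E ≡ 2 * n'
  length-E = trans (length-++ (R a L)) (trans (cong₂ _+_ (length-R a L)
               (trans (length-++ (R c M)) (cong₂ _+_ (length-R c M) (length-R d L)))) runs-size)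

  -- The order isomorphism ι : [1, 2n'] → S, v ↦ the v-th element of E.  The
  -- facts below are the hypotheses of the relabelling lemma for ι.
  ι : ℕ → ℕ
  ι v = nth E (v ∸ 1)

  private
    Dom : ℕ → Set
    Dom = InRange (2 * n')

    index< : ∀ {v} → Dom v → v ∸ 1 < length E
    index< {suc i} (_ , le) = subst (i <_) (sym length-E) le

  ι-mono : ∀ {x y} → Dom x → Dom y → x < y → ι x < ι y
  ι-mono {suc i} {suc j} _ dy (s≤s i<j) = nth-sorted E-sorted i<j (index< dy)

  ι-in : ∀ {v} → Dom v → InRange N (ι v)
  ι-in dv = nth-All E-in _ (index< dv)

  ι-comp : ∀ {v} → Dom v → ι (suc (2 * n') ∸ v) ≡ suc N ∸ ι v
  ι-comp {suc i} dv = begin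
      nth E (2 * n' ∸ i ∸ 1)
    ≡⟨ cong (nth E) (trans (∸-+-assoc (2 * n') i 1) (cong (2 * n' ∸_) (+-comm i 1))) ⟩
      nth E (2 * n' ∸ suc i)
    ≡⟨ cong₂ (λ xs l → nth xs (l ∸ suc i)) (sym E-symmetric) (sym len) ⟩
      nth (reverse (map κ E)) (length (map κ E) ∸ suc i)
    ≡⟨ nth-reverse (map κ E) i (subst (i <_) (sym (length-map κ E)) (index< dv)) ⟩
      nth (map κ E) i
    ≡⟨ nth-map κ E i (index< dv) ⟩
      κ (nth E i) ∎
    where
    open ≡-Reasoning
    κ : ℕ → ℕ
    κ = suc N ∸_
    len : length (map κ E) ≡ 2 * n'
    len = trans (length-map κ E) length-E

  ι-below : ∀ {t} → Dom t → t ≤ L + M → ι t < u'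
  ι-below {suc i} dt t≤ = begin-strict
      nth E i
    ≡⟨ cong (λ xs → nth xs i) (sym (++-assoc (R a L) (R c M) (R d L))) ⟩
      nth ((R a L ++ R c M) ++ R d L) i
    ≡⟨ nth-++ˡ (R a L ++ R c M) (R d L) i i<lower ⟩
      nth (R a L ++ R c M) i
    <⟨ nth-All E-below i i<lower ⟩
      u' ∎
    where
    open ≤-Reasoning
    i<lower : i < length (R a L ++ R c M)
    i<lower = subst (i <_) (sym (trans (length-++ (R a L)) (cong₂ _+_ (length-R a L) (length-R c M)))) t≤

  E-map : map ι (R 1 (2 * n')) ≡ E
  E-map = subst (λ m → map ι (R 1 m) ≡ E) length-E (map-nth-R E 1)

  open Relabel N (2 * n') ι ι-mono ι-comp (λ dv → proj₁ (ι-in dv))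

  assemble : ℕ → ℕ → List ℕ → List ℕ
  assemble x₀ x₁ τ = (x₀ ∷ reverse high) ++ embed S τ ++ reverse low ++ (x₁ ∷ [])

  private
    length-high : length (reverse high) ≡ p
    length-high = trans (length-reverse high) (trans (cong length high-R) (length-R (d + L) p))

    embed-E : ∀ τ → embed S τ ≡ map ι τ
    embed-E τ = cong (λ A → map (λ v → nth A (v ∸ 1)) τ) S≡E

    med-N : med (range 1 N) ≡ n
    med-N = trans (cong (λ m → med (range 1 (2 * m))) n-split) (trans (med-range (p + n')) (sym n-split))

  word-assemble : ∀ x₀ x₁ τ → InRange N x₀ → InRange N x₁ → Word n' τ → Word n (assemble x₀ x₁ τ)
  word-assemble x₀ x₁ τ x₀-in x₁-in (lenτ , τ-in) =
    len , x₀-in ∷ ++⁺ high-in (++⁺ embed-in (++⁺ low-in (x₁-in ∷ [])))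
    where
    len : length (assemble x₀ x₁ τ) ≡ N
    len rewrite length-++ (reverse high) {embed S τ ++ reverse low ++ (x₁ ∷ [])}
              | length-++ (embed S τ) {reverse low ++ (x₁ ∷ [])}
              | length-++ (reverse low) {x₁ ∷ []}
              | length-high | length-map (λ v → nth S (v ∸ 1)) τ | lenτ
              | length-reverse low | trans (cong length low-R) (length-R 1 p) = length-assembled
    high-in : All (InRange N) (reverse high)
    high-in = All-reverse (subst (All (InRange N)) (sym high-R)
                (All-R (d + L) p λ {x} le x< → ≤-trans (s≤s z≤n) le , ≤-pred (subst (x <_) top x<)))
    embed-in : All (InRange N) (embed S τ)
    embed-in = subst (All (InRange N)) (sym (embed-E τ)) (map⁺ (All.map ι-in τ-in))
    p≤N : p ≤ N
    p≤N = ≤-pred (≤-trans (<-trans p<u u<d+L) d+L≤sN)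
    low-in : All (InRange N) (reverse low)
    low-in = All-reverse (subst (All (InRange N)) (sym low-R)
               (All-R 1 p λ 1≤x x< → 1≤x , ≤-trans (≤-pred x<) p≤N))

  -- The scan over assemble x₀ x₁ τ: x₀ is a left-to-right minimum, tiny iff
  -- x₀ = n; the block N, …, N+1-p is skipped, after which the current set is
  -- exactly S; from there on the scan is the scan of τ relabelled by ι.
  tiny-assemble : ∀ x₀ x₁ τ →
    (∀ x → elem x (x₀ ∷ suc N ∸ x₀ ∷ []) ≡ elem x (u ∷ u' ∷ [])) → u' ≤ suc x₀ → x₀ < d →
    Word n' τ → FirstAtMost (L + M) n' τ →
    tiny n (assemble x₀ x₁ τ) ≡ (if x₀ ≡ᵇ n then 1 else 0) + tiny n' τ
  tiny-assemble x₀ x₁ τ pair u'≤ x₀<d (lenτ , τ-in) first = begin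
      tinyGo N (range 1 N) (suc N) (take n σ)
    ≡⟨ cong (tinyGo N (range 1 N) (suc N)) prefix ⟩
      tinyGo N (range 1 N) (suc N) (x₀ ∷ ys ++ embed S w)
    ≡⟨ first-entry ⟩
      B + tinyGo N (remove X₀ (range 1 N)) x₀ (ys ++ embed S w)
    ≡⟨ cong (B +_) (tiny-skip N (remove X₀ (range 1 N)) x₀ ys (embed S w) ys-above) ⟩
      B + tinyGo N (remove (pairs N ys) (remove X₀ (range 1 N))) x₀ (embed S w)
    ≡⟨ cong (λ A → B + tinyGo N A x₀ (embed S w))
            (trans (remove-remove X₀ (pairs N ys) (range 1 N))
                   (remove-cong {X₀ ++ pairs N ys} {Rm} (removed-set x₀ pair) (range 1 N))) ⟩
      B + tinyGo N S x₀ (embed S w)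
    ≡⟨ cong (λ A → B + tinyGo N A x₀ (map (λ v → nth A (v ∸ 1)) w)) S≡E ⟩
      B + tinyGo N E x₀ (map ι w)
    ≡⟨ cong (B +_) relabelled ⟩
      B + tiny n' τ
    ≡⟨ cong (λ m → (if x₀ ≡ᵇ m then 1 else 0) + tiny n' τ) med-N ⟩
      (if x₀ ≡ᵇ n then 1 else 0) + tiny n' τ ∎
    where
    open ≡-Reasoning
    σ = assemble x₀ x₁ τ
    ys = reverse high
    w = take n' τ
    X₀ = x₀ ∷ suc N ∸ x₀ ∷ []
    B = if x₀ ≡ᵇ med (range 1 N) then 1 else 0

    prefix : take n σ ≡ x₀ ∷ ys ++ embed S w
    prefix = begin
        take n σ
      ≡⟨ cong (λ m → take m σ) (trans n-split (cong (λ l → suc (l + n')) (sym length-high))) ⟩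
        take (length (x₀ ∷ ys) + n') ((x₀ ∷ ys) ++ embed S τ ++ reverse low ++ (x₁ ∷ []))
      ≡⟨ take-++-prefix (x₀ ∷ ys) _ n' ⟩
        (x₀ ∷ ys) ++ take n' (embed S τ ++ reverse low ++ (x₁ ∷ []))
      ≡⟨ cong ((x₀ ∷ ys) ++_) (take-++-short (embed S τ) _ n' n'≤) ⟩
        (x₀ ∷ ys) ++ take n' (embed S τ)
      ≡⟨ cong ((x₀ ∷ ys) ++_) (take-map n' τ) ⟩
        x₀ ∷ ys ++ embed S w ∎
      where
      n'≤ : n' ≤ length (embed S τ)
      n'≤ = subst (n' ≤_) (sym (trans (length-map _ τ) lenτ)) (m≤m+n n' (n' + 0))

    first-entry : tinyGo N (range 1 N) (suc N) (x₀ ∷ ys ++ embed S w)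
                ≡ B + tinyGo N (remove X₀ (range 1 N)) x₀ (ys ++ embed S w)
    first-entry rewrite ≤ᵇ-true (≤-trans (<⇒≤ x₀<d) (≤-trans (m≤m+n d L) d+L≤sN)) = refl

    ys-above : All (x₀ <_) ys
    ys-above = All-reverse (subst (All (x₀ <_)) (sym high-R)
                 (All-R (d + L) p λ le _ → <-≤-trans x₀<d (≤-trans (m≤m+n d L) le)))

    relabelled : tinyGo N E x₀ (map ι w) ≡ tiny n' τ
    relabelled with take n' τ in eq | take⁺ n' τ-in
    ... | []     | _           = refl
    ... | t ∷ ts | dt ∷ dts = begin
        tinyGo N E x₀ (map ι (t ∷ ts))
      ≡⟨ cong (λ A → tinyGo N A x₀ (map ι (t ∷ ts))) (sym E-map) ⟩
        tinyGo N (map ι (R 1 (2 * n'))) x₀ (map ι (t ∷ ts))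
      ≡⟨ relabel-head (R 1 (2 * n')) x₀ (suc (2 * n')) t ts
           (All-R 1 (2 * n') λ 1≤x x< → 1≤x , ≤-pred x<) dt dts
           (≤-pred (≤-trans (ι-below dt (first t ts refl)) u'≤)) (≤-trans (proj₂ dt) (n≤1+n _)) ⟩
        tinyGo (2 * n') (R 1 (2 * n')) (suc (2 * n')) (t ∷ ts)
      ≡⟨ cong (λ A → tinyGo (2 * n') A (suc (2 * n')) (t ∷ ts)) (sym (range-R 1 (2 * n'))) ⟩
        tinyGo (2 * n') (range 1 (2 * n')) (suc (2 * n')) (t ∷ ts) ∎

  -- Branch (a) of Ψ: x₀ = N+1-u > n is not tiny.
  upper : ∀ τ → Word n' τ → FirstAtMost (L + M) n' τ →
    Word n (assemble u' u τ) × tiny n (assemble u' u τ) ≡ tiny n' τ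
  upper τ wτ first =
    word-assemble u' u τ (below-top (≤-trans (s≤s z≤n) (<⇒≤ u<u')) u'<d+L)
                         (below-top (s≤s z≤n) u<d+L) wτ ,
    trans (tiny-assemble u' u τ pair (n≤1+n u') ≤-refl wτ first)
          (cong (_+ tiny n' τ) (cong (λ b → if b then 1 else 0) (≡ᵇ-false (≢-sym (<⇒≢ n<u')))))
    where
    pair : ∀ x → elem x (u' ∷ suc N ∸ u' ∷ []) ≡ elem x (u ∷ u' ∷ [])
    pair x rewrite comp-u' = elem-swap x u' u

  -- Branches (b), (c) of Ψ: here h = 0 and x₀ = u = n is tiny.
  lower : h ≡ 0 → ∀ τ → Word n' τ → FirstAtMost (L + M) n' τ →
    Word n (assemble u u' τ) × tiny n (assemble u u' τ) ≡ suc (tiny n' τ)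
  lower h≡0 τ wτ first =
    word-assemble u u' τ (below-top (s≤s z≤n) u<d+L)
                         (below-top (≤-trans (s≤s z≤n) (<⇒≤ u<u')) u'<d+L) wτ ,
    trans (tiny-assemble u u' τ pair u'≤ (<-trans u<u' u'<d) wτ first)
          (cong (_+ tiny n' τ) (cong (λ b → if b then 1 else 0) (≡ᵇ-true (sym n≡u))))
    where
    n≡u : n ≡ u
    n≡u = cong (_+ u) h≡0
    u'≤ : u' ≤ suc u
    u'≤ = ≤-reflexive (cong (λ k → k + k + suc u) h≡0)
    pair : ∀ x → elem x (u ∷ suc N ∸ u ∷ []) ≡ elem x (u ∷ u' ∷ [])
    pair x rewrite comp-u = refl

data DyckFrom : ℕ → List Step → Set where
  end  : ∀ {h} → DyckFrom h []
  up   : ∀ {h π} → DyckFrom (suc h) π → DyckFrom h (U ∷ π)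
  down : ∀ {h π} → DyckFrom h π → DyckFrom (suc h) (D ∷ π)

dyck-from : ∀ h π → (∀ m → m ≤ length π → #D (take m π) ≤ h + #U (take m π)) → DyckFrom h π
dyck-from h       []      _ = end
dyck-from h       (U ∷ π) H =
  up (dyck-from (suc h) π λ m le → subst (#D (take m π) ≤_) (+-suc h _) (H (suc m) (s≤s le)))
dyck-from zero    (D ∷ π) H with () ← H 1 (s≤s z≤n)
dyck-from (suc h) (D ∷ π) H = down (dyck-from h π λ m le → ≤-pred (H (suc m) (s≤s le)))

dyck-short : ∀ h π → length π ≤ h → DyckFrom h π
dyck-short h       []      _        = end
dyck-short h       (U ∷ π) le       = up (dyck-short (suc h) π (≤-trans (n≤1+n _) (≤-trans le (n≤1+n h))))
dyck-short (suc h) (D ∷ π) (s≤s le) = down (dyck-short h π le)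

dyck-ups⁻ : ∀ m {h} π → DyckFrom h (replicate m U ++ π) → DyckFrom (m + h) π
dyck-ups⁻ zero    π dπ      = dπ
dyck-ups⁻ (suc m) {h} π (up dπ) = subst (λ k → DyckFrom k π) (+-suc m h) (dyck-ups⁻ m π dπ)

dyck-ups⁺ : ∀ m {h} π → DyckFrom (m + h) π → DyckFrom h (replicate m U ++ π)
dyck-ups⁺ zero    π dπ = dπ
dyck-ups⁺ (suc m) {h} π dπ = up (dyck-ups⁺ m π (subst (λ k → DyckFrom k π) (sym (+-suc m h)) dπ))

dyck-downs⁻ : ∀ m {h} π → DyckFrom h (replicate m D ++ π) → m ≤ h × DyckFrom (h ∸ m) π
dyck-downs⁻ zero    π dπ        = z≤n , dπ
dyck-downs⁻ (suc m) π (down dπ) with dyck-downs⁻ m π dπ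
... | m≤h , dπ' = s≤s m≤h , dπ'

count-U : ∀ j k π → #U (replicate j U ++ replicate k D ++ π) ≡ j + #U π
count-U (suc j) k π = cong suc (count-U j k π)
count-U zero    zero    π = refl
count-U zero    (suc k) π = count-U zero k π

count-D : ∀ j k π → #D (replicate j U ++ replicate k D ++ π) ≡ k + #D π
count-D (suc j) k π = count-D j k π
count-D zero    zero    π = refl
count-D zero    (suc k) π = cong suc (count-D zero k π)

length-UD : ∀ j k (π : List Step) → length (replicate j U ++ replicate k D ++ π) ≡ j + (k + length π)
length-UD j k π = trans (length-++ (replicate j U))
  (cong₂ _+_ (length-replicate j) (trans (length-++ (replicate k D)) (cong (_+ length π) (length-replicate k))))

lead-U-split : ∀ π → π ≡ replicate (proj₁ (lead U π)) U ++ proj₂ (lead U π)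
lead-U-split []      = refl
lead-U-split (U ∷ π) = cong (U ∷_) (lead-U-split π)
lead-U-split (D ∷ π) = refl

lead-D-split : ∀ π → π ≡ replicate (proj₁ (lead D π)) D ++ proj₂ (lead D π)
lead-D-split []      = refl
lead-D-split (U ∷ π) = refl
lead-D-split (D ∷ π) = cong (D ∷_) (lead-D-split π)

lead-ups : ∀ m π → proj₁ (lead U (replicate m U ++ π)) ≡ m + proj₁ (lead U π)
lead-ups zero    π = refl
lead-ups (suc m) π = cong suc (lead-ups m π)

StartsUp : List Step → Set
StartsUp π' = π' ≡ [] ⊎ ∃ λ s → π' ≡ U ∷ s

rest-shape : ∀ π → let r = proj₂ (lead U π) in
  StartsUp (proj₂ (lead D r)) × (proj₁ (lead D r) ≡ 0 → proj₂ (lead D r) ≡ [])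
rest-shape π = shape (proj₂ (lead U π)) (no-U π)
  where
  no-U : ∀ π s → proj₂ (lead U π) ≢ U ∷ s
  no-U (U ∷ π) s e = no-U π s e

  no-D : ∀ π s → proj₂ (lead D π) ≢ D ∷ s
  no-D (D ∷ π) s e = no-D π s e

  starts : ∀ π' → (∀ s → π' ≢ D ∷ s) → StartsUp π'
  starts []      _  = inj₁ refl
  starts (U ∷ s) _  = inj₂ (s , refl)
  starts (D ∷ s) nd = ⊥-elim (nd s refl)

  shape : ∀ r → (∀ s → r ≢ U ∷ s) →
    StartsUp (proj₂ (lead D r)) × (proj₁ (lead D r) ≡ 0 → proj₂ (lead D r) ≡ [])
  shape []      _  = inj₁ refl , λ _ → refl
  shape (U ∷ r) nu = ⊥-elim (nu r refl)
  shape (D ∷ r) _  = starts (proj₂ (lead D r)) (no-D r) , λ ()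

-- The three branches of Ψ for π = Uʲ Dᵏ π', as written locally in psiF of
-- Defs (with fuel f for the recursive call); psiF reduces to them.
branchA branchB branchC : ℕ → ℕ → ℕ → ℕ → List Step → List ℕ
branchA f n j k π' =
  ((suc (2 * n) ∸ j) ∷ reverse (range (2 * n + 2 ∸ k) (2 * n)))
  ++ embed (without (2 * n) (range 1 (k ∸ 1) ++ (j ∷ (suc (2 * n) ∸ j) ∷ []) ++ range (2 * n + 2 ∸ k) (2 * n)))
           (psiF f (n ∸ k) (replicate (j ∸ k) U ++ π'))
  ++ reverse (range 1 (k ∸ 1)) ++ (j ∷ [])
branchB f n j k π' =
  (n ∷ reverse (range (suc (2 * n) ∸ k) (2 * n)))
  ++ embed (without (2 * n) (range 1 k ++ (n ∷ suc n ∷ []) ++ range (suc (2 * n) ∸ k) (2 * n)))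
           (psiF f (n ∸ suc k) (replicate (n ∸ suc k) U ++ π'))
  ++ reverse (range 1 k) ++ (suc n ∷ [])
branchC f n j k π' =
  (n ∷ [])
  ++ embed (without (2 * n) (n ∷ suc n ∷ []))
           (psiF f (n ∸ 1) (replicate (j ∸ 2) U ++ replicate k D ++ π'))
  ++ (suc n ∷ [])

if-cases : ∀ {A : Set} (P : A → Set) b₁ b₂ {x y z : A} →
  (b₁ ≡ true → P x) → (b₁ ≡ false → b₂ ≡ true → P y) → (b₁ ≡ false → b₂ ≡ false → P z) →
  P (if b₁ then x else if b₂ then y else z)
if-cases P true  _     hx _  _  = hx refl
if-cases P false true  _  hy _  = hy refl refl
if-cases P false false _  _  hz = hz refl refl

psi-head : ∀ f n s ss → let j = proj₁ (lead U (s ∷ ss)) in ∃ λ rest →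
  psiF (suc f) n (s ∷ ss) ≡ (if j ≤ᵇ n then suc (2 * n) ∸ j else n) ∷ rest
psi-head f n s ss with proj₁ (lead U (s ∷ ss)) ≤ᵇ n | proj₁ (lead U (s ∷ ss)) ≡ᵇ suc n
... | true  | _     = _ , refl
... | false | true  = _ , refl
... | false | false = _ , refl

first-bound : ∀ f L h π → length π ≡ 2 * (h + L) → π ≡ replicate L U ⊎ L < proj₁ (lead U π) →
  FirstAtMost (L + (h + h)) (h + L) (psiF (suc f) (h + L) π)
first-bound f L h π len (inj₁ refl) t ts eq =
  ⊥-elim (reads-nothing (subst (λ m → take m (psiF (suc f) (h + L) π) ≡ t ∷ ts) empty eq))
  where
  reads-nothing : take 0 (psiF (suc f) (h + L) π) ≡ t ∷ ts → ⊥
  reads-nothing ()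
  empty : h + L ≡ 0
  empty = twice≤⇒0 (subst (_≤ h + L) (trans (sym (length-replicate L)) len) (m≤n+m L h))
first-bound f L h (s ∷ ss) len (inj₂ L<j) t ts eq
  with psi-head f (h + L) s ss
... | rest , ψ≡ rewrite ψ≡ | take-head (h + L) _ rest eq = head≤
  where
  j : ℕ
  j = proj₁ (lead U (s ∷ ss))
  head≤ : (if j ≤ᵇ h + L then suc (2 * (h + L)) ∸ j else h + L) ≤ L + (h + h)
  head≤ with j ≤ᵇ h + L
  ... | true  = ≤-trans (∸-monoʳ-≤ (suc (2 * (h + L))) L<j) (≤-reflexive limit)
    where
    limit : 2 * (h + L) ∸ L ≡ L + (h + h)
    limit = trans (cong (_∸ L) (eq′ h L)) (m+n∸n≡m (L + (h + h)) L)
      where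
      eq′ : ∀ h L → 2 * (h + L) ≡ L + (h + h) + L
      eq′ = solve-∀
  ... | false = subst (_≤ L + (h + h)) (+-comm L h) (+-monoʳ-≤ L (m≤m+n h h))

Correct : ℕ → ℕ → List Step → Set
Correct f n π = Word n (psiF f n π) × #U π ≡ #D π + 2 * tiny n (psiF f n π)

Hyp : ℕ → Set
Hyp f = ∀ n π → DyckFrom 0 π → length π ≡ 2 * n → n < f → Correct f n π

BranchGood : ℕ → ℕ → ℕ → List Step → List ℕ → Set
BranchGood n j k π' σ = Word n σ × j + #U π' ≡ k + #D π' + 2 * tiny n σ

counts-UD : ∀ m k π' t →
  #U (replicate m U ++ replicate k D ++ π') ≡ #D (replicate m U ++ replicate k D ++ π') + 2 * t →
  m + #U π' ≡ k + #D π' + 2 * t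
counts-UD m k π' t e = trans (sym (count-U m k π')) (trans e (cong (_+ 2 * t) (count-D m k π')))

height-step : ∀ a c x y t → c + x ≡ y + 2 * t → a + c + x ≡ a + y + 2 * t
height-step a c x y t e = trans (+-assoc a c x) (trans (cong (a +_) e) (sym (+-assoc a y (2 * t))))

height-tiny : ∀ m x z t → m + x ≡ z + 2 * t → 2 + m + x ≡ z + 2 * suc t
height-tiny m x z t e = trans (cong (λ w → suc (suc w)) e) (eq z t)
  where
  eq : ∀ z t → suc (suc (z + 2 * t)) ≡ z + 2 * suc t
  eq = solve-∀

ups-then : ∀ L π' → StartsUp π' →
  replicate L U ++ π' ≡ replicate L U ⊎ L < proj₁ (lead U (replicate L U ++ π'))
ups-then L π' (inj₁ refl)      = inj₁ (++-identityʳ (replicate L U))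
ups-then L π' (inj₂ (s , refl)) =
  inj₂ (subst (L <_) (sym (lead-ups L (U ∷ s)))
              (subst (_≤ L + suc (proj₁ (lead U s))) (+-comm L 1) (+-monoʳ-≤ L (s≤s z≤n))))

-- Branch (a): j ≤ n.  With k = p+1, j = k+L and n = h+j, the output is
-- assemble (N+1-j) j Ψ(Uᴸπ'), and Uᴸπ' has half-length h+L.
branchA-correct : ∀ f p L h π' → Hyp (suc f) → h + suc (p + L) ≤ suc f →
  DyckFrom L π' → length π' ≡ L + (h + h) → StartsUp π' →
  BranchGood (h + suc (p + L)) (suc p + L) (suc p) π' (branchA (suc f) (h + suc (p + L)) (suc p + L) (suc p) π')
branchA-correct f p L h π' ih n≤ dπ' lenπ' starts =
  subst (BranchGood n u (suc p) π') (sym shape)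
    (proj₁ framed ,
     trans (height-step (suc p) L (#U π') (#D π') (tiny n' τ)
             (counts-UD L 0 π' (tiny n' τ) (proj₂ rec)))
           (cong (λ t → suc p + #D π' + 2 * t) (sym (proj₂ framed))))
  where
  open Frame p L h
  π̂ = replicate L U ++ π'
  τ = psiF (suc f) n' π̂
  length-π̂ : length π̂ ≡ 2 * n'
  length-π̂ = trans (length-UD L 0 π') (trans (cong (L +_) lenπ') (eq L h))
    where
    eq : ∀ L h → L + (L + (h + h)) ≡ 2 * (h + L)
    eq = solve-∀
  rec : Correct (suc f) n' π̂
  rec = ih n' π̂ (dyck-ups⁺ L π' (subst (λ m → DyckFrom m π') (sym (+-identityʳ L)) dπ')) length-π̂
           (<-≤-trans (+-monoʳ-< h (s≤s (m≤n+m L p))) n≤)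
  framed = upper τ (proj₁ rec) (first-bound f L h π̂ length-π̂ (ups-then L π' starts))
  n∸k : n ∸ suc p ≡ n'
  n∸k = trans (cong (_∸ suc p) (eq p L h)) (m+n∸m≡n (suc p) (h + L))
    where
    eq : ∀ p L h → h + suc (p + L) ≡ suc p + (h + L)
    eq = solve-∀
  shape : branchA (suc f) n u (suc p) π' ≡ assemble u' u τ
  shape rewrite comp-u | cong (_∸ suc p) (+-comm (2 * n) 2) | m+n∸m≡n (suc p) L | n∸k = refl

-- Branch (b): j = n+1.  With k = p and L = |π'|, n = p+L+1 and the output is
-- assemble n (n+1) Ψ(Uᴸπ'), where Uᴸπ' has half-length L.
branchB-correct : ∀ f p L π' → Hyp (suc f) → suc (p + L) ≤ suc f → length π' ≡ L → StartsUp π' →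
  BranchGood (suc (p + L)) (suc (suc (p + L))) p π' (branchB (suc f) (suc (p + L)) (suc (suc (p + L))) p π')
branchB-correct f p L π' ih n≤ lenπ' starts =
  subst (BranchGood n (suc n) p π') (sym shape)
    (proj₁ framed ,
     trans (height-tiny (p + L) (#U π') (p + #D π') (tiny L τ)
             (height-step p L (#U π') (#D π') (tiny L τ)
               (counts-UD L 0 π' (tiny L τ) (proj₂ rec))))
           (cong (λ t → p + #D π' + 2 * t) (sym (proj₂ framed))))
  where
  open Frame p L 0
  π̂ = replicate L U ++ π'
  τ = psiF (suc f) L π̂
  length-π̂ : length π̂ ≡ 2 * L
  length-π̂ = trans (length-UD L 0 π') (cong (L +_) (trans lenπ' (sym (+-identityʳ L))))
  rec : Correct (suc f) L π̂
  rec = ih L π̂ (dyck-ups⁺ L π' (dyck-short (L + 0) π' (subst (_≤ L + 0) (sym lenπ') (m≤m+n L 0))))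
           length-π̂ (<-≤-trans (s≤s (m≤n+m L p)) n≤)
  framed = lower refl τ (proj₁ rec) (first-bound f L 0 π̂ length-π̂ (ups-then L π' starts))
  shape : branchB (suc f) n (suc n) p π' ≡ assemble u u' τ
  shape rewrite m+n∸m≡n p L = refl

-- Branch (c): j ≥ n+2.  With n = L+1 and j = n+2+e the output is
-- assemble n (n+1) Ψ(Uʲ⁻²Dᵏπ'), where Uʲ⁻²Dᵏπ' has half-length L.
branchC-correct : ∀ f L e k π' → Hyp (suc f) → suc L ≤ suc f → L ≡ suc (e + (k + length π')) →
  BranchGood (suc L) (suc (suc (suc L)) + e) k π' (branchC (suc f) (suc L) (suc (suc (suc L)) + e) k π')
branchC-correct f L e k π' ih n≤ L≡ =
  subst (BranchGood n (suc (suc n) + e) k π') (sym shape)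
    (proj₁ framed ,
     trans (height-tiny (suc L + e) (#U π') (k + #D π') (tiny L τ)
             (counts-UD (suc L + e) k π' (tiny L τ) (proj₂ rec)))
           (cong (λ t → k + #D π' + 2 * t) (sym (proj₂ framed))))
  where
  open Frame 0 L 0
  π̂ = replicate (suc L + e) U ++ replicate k D ++ π'
  τ = psiF (suc f) L π̂
  length-π̂ : length π̂ ≡ 2 * L
  length-π̂ = trans (length-UD (suc L + e) k π')
                   (trans (eq L e (k + length π')) (cong (λ m → L + (m + 0)) (sym L≡)))
    where
    eq : ∀ L e r → suc L + e + r ≡ L + (suc (e + r) + 0)
    eq = solve-∀
  rest-short : length (replicate k D ++ π') ≤ suc L + e + 0
  rest-short = subst₂ _≤_ (sym (length-UD 0 k π')) (sym (+-identityʳ (suc L + e)))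
    (≤-trans (m≤n+m (k + length π') e) (≤-trans (n≤1+n _) (≤-trans (≤-reflexive (sym L≡))
      (≤-trans (n≤1+n L) (m≤m+n (suc L) e)))))
  rec : Correct (suc f) L π̂
  rec = ih L π̂ (dyck-ups⁺ (suc L + e) _ (dyck-short _ _ rest-short)) length-π̂ (<-≤-trans ≤-refl n≤)
  many-ups : L < proj₁ (lead U π̂)
  many-ups = subst (L <_) (sym (lead-ups (suc L + e) _)) (s≤s (≤-trans (m≤m+n L e) (m≤m+n (L + e) _)))
  framed = lower refl τ (proj₁ rec) (first-bound f L 0 π̂ length-π̂ (inj₂ many-ups))
  shape : branchC (suc f) n (suc (suc n) + e) k π' ≡ assemble u u' τ
  shape rewrite range-empty N = refl

≤-witness : ∀ {m n} → m ≤ n → ∃ λ k → n ≡ m + k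
≤-witness {zero}  {n}     z≤n      = n , refl
≤-witness {suc m} {suc n} (s≤s le) = let k , e = ≤-witness le in k , cong suc e

≤-witnessˡ : ∀ {m n} → m ≤ n → ∃ λ k → n ≡ k + m
≤-witnessˡ {m} le = let k , e = ≤-witness le in k , trans e (+-comm m k)

caseA : ∀ f n j k π' → Hyp (suc f) → n ≤ suc f → 1 ≤ j → j ≤ n → k ≤ j → DyckFrom (j ∸ k) π' →
  j + (k + length π') ≡ 2 * n → StartsUp π' → (k ≡ 0 → π' ≡ []) →
  BranchGood n j k π' (branchA (suc f) n j k π')
caseA f n j zero π' _ _ 1≤j j≤n _ _ len _ no-rest = ⊥-elim (<⇒≱ 1≤j (≤-reflexive j≡0))
  where
  j≡2n : j ≡ 2 * n
  j≡2n = trans (sym (trans (cong (λ π → j + length π) (no-rest refl)) (+-identityʳ j))) len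
  j≡0 : j ≡ 0
  j≡0 = n≤0⇒n≡0 (subst (j ≤_) (twice≤⇒0 (subst (_≤ n) j≡2n j≤n)) j≤n)
caseA f n j (suc p) π' ih n≤ _ j≤n k≤j dπ' len starts _ with ≤-witness k≤j
... | L , refl with ≤-witnessˡ j≤n
...   | h , refl =
  branchA-correct f p L h π' ih n≤ (subst (λ m → DyckFrom m π') (m+n∸m≡n (suc p) L) dπ') lenπ' starts
  where
  lenπ' : length π' ≡ L + (h + h)
  lenπ' = +-cancelˡ-≡ (suc p) _ _ (+-cancelˡ-≡ (suc p + L) _ _ (trans len (eq p L h)))
    where
    eq : ∀ p L h → 2 * (h + (suc p + L)) ≡ suc p + L + (suc p + (L + (h + h)))
    eq = solve-∀

caseB : ∀ f n j k π' → Hyp (suc f) → n ≤ suc f → j ≡ suc n → j + (k + length π') ≡ 2 * n →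
  StartsUp π' → BranchGood n j k π' (branchB (suc f) n j k π')
caseB f n _ k π' ih n≤ refl len starts with half n k (length π') len
  where
  half : ∀ n k r → suc n + (k + r) ≡ 2 * n → n ≡ suc (k + r)
  half n k r e = sym (+-cancelˡ-≡ n _ _ (trans (eq n k r) (trans e (cong (n +_) (+-identityʳ n)))))
    where
    eq : ∀ n k r → n + suc (k + r) ≡ suc n + (k + r)
    eq = solve-∀
... | refl = branchB-correct f k (length π') π' ih n≤ refl starts

caseC : ∀ f n j k π' → Hyp (suc f) → n ≤ suc f → suc (suc n) ≤ j → j + (k + length π') ≡ 2 * n →
  BranchGood n j k π' (branchC (suc f) n j k π')
caseC f zero    _ k π' _  _  (s≤s (s≤s _)) ()
caseC f (suc L) j k π' ih n≤ n+2≤j len with ≤-witness n+2≤j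
... | e , refl = branchC-correct f L e k π' ih n≤ (half L e (k + length π') len)
  where
  half : ∀ L e r → suc (suc (suc L)) + e + r ≡ 2 * suc L → L ≡ suc (e + r)
  half L e r h = sym (+-cancelˡ-≡ (suc (suc L)) _ _ (trans (eq L e r) (trans h (eq′ L))))
    where
    eq : ∀ L e r → suc (suc L) + suc (e + r) ≡ suc (suc (suc L)) + e + r
    eq = solve-∀
    eq′ : ∀ L → 2 * suc L ≡ suc (suc L) + L
    eq′ = solve-∀

correct-step : ∀ f → Hyp (suc f) → ∀ n ss → DyckFrom 0 (U ∷ ss) → length (U ∷ ss) ≡ 2 * n →
  n ≤ suc f → Correct (suc (suc f)) n (U ∷ ss)
correct-step f ih n ss dπ len n≤ =
  if-cases Good (j ≤ᵇ n) (j ≡ᵇ suc n)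
    (λ j≤n → from-branch
               (caseA f n j k π' ih n≤ (s≤s z≤n) (≤ᵇ-sound j≤n) k≤j dπ' length-split starts no-rest))
    (λ _ j≡n+1 → from-branch (caseB f n j k π' ih n≤ (≡ᵇ-sound j≡n+1) length-split starts))
    (λ j≰n j≢n+1 → from-branch (caseC f n j k π' ih n≤ (n+2≤j j≰n j≢n+1) length-split))
  where
  π = U ∷ ss
  j = proj₁ (lead U π)
  r = proj₂ (lead U π)
  k = proj₁ (lead D r)
  π' = proj₂ (lead D r)
  starts = proj₁ (rest-shape π)
  no-rest = proj₂ (rest-shape π)

  Good : List ℕ → Set
  Good σ = Word n σ × #U π ≡ #D π + 2 * tiny n σ

  split : π ≡ replicate j U ++ replicate k D ++ π'
  split = trans (lead-U-split π) (cong (replicate j U ++_) (lead-D-split r))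

  length-split : j + (k + length π') ≡ 2 * n
  length-split = trans (sym (length-UD j k π')) (trans (cong length (sym split)) len)

  downs : k ≤ j + 0 × DyckFrom (j + 0 ∸ k) π'
  downs = dyck-downs⁻ k π' (dyck-ups⁻ j (replicate k D ++ π') (subst (DyckFrom 0) split dπ))

  k≤j : k ≤ j
  k≤j = subst (k ≤_) (+-identityʳ j) (proj₁ downs)

  dπ' : DyckFrom (j ∸ k) π'
  dπ' = subst (λ m → DyckFrom (m ∸ k) π') (+-identityʳ j) (proj₂ downs)

  n+2≤j : (j ≤ᵇ n) ≡ false → (j ≡ᵇ suc n) ≡ false → suc (suc n) ≤ j
  n+2≤j j≰n j≢n+1 = ≤∧≢⇒< (≰⇒> λ j≤n → true≢false (trans (sym (≤ᵇ-true j≤n)) j≰n))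
                          (λ e → true≢false (trans (sym (≡ᵇ-true (sym e))) j≢n+1))
    where
    true≢false : true ≢ false
    true≢false ()

  from-branch : ∀ {σ} → BranchGood n j k π' σ → Good σ
  from-branch {σ} (wσ , e) =
    wσ , trans (trans (cong #U split) (count-U j k π'))
               (trans e (cong (_+ 2 * tiny n σ) (sym (trans (cong #D split) (count-D j k π')))))

correct : ∀ f → Hyp f
correct zero          n π        _  _   ()
correct (suc f)       n []       _  len _ rewrite take-[] {A = ℕ} n = (len , []) , refl
correct (suc zero)    n (s ∷ ss) _  len (s≤s n≤0) with () ← trans len (cong (2 *_) (n≤0⇒n≡0 n≤0))
correct (suc (suc f)) n (U ∷ ss) dπ len (s≤s n≤) = correct-step f (correct (suc f)) n ss dπ len n≤
correct (suc (suc f)) n (D ∷ ss) () _ _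

open import Data.Integer using (+_; _-_; _⊖_)
open import Data.Integer.Properties using (m-n≡m⊖n; ⊖-≥)

height-counts : ∀ π t → #U π ≡ #D π + t → height π ≡ + t
height-counts π t e = begin
    + #U π - + #D π
  ≡⟨ cong (λ x → + x - + #D π) e ⟩
    + (#D π + t) - + #D π
  ≡⟨ m-n≡m⊖n (#D π + t) (#D π) ⟩
    (#D π + t) ⊖ #D π
  ≡⟨ ⊖-≥ (m≤m+n (#D π) t) ⟩
    + (#D π + t ∸ #D π)
  ≡⟨ cong +_ (m+n∸m≡n (#D π) t) ⟩
    + t ∎
  where open ≡-Reasoning

theorem7 : (n : ℕ) (σ : List ℕ) → InC n σ →
           (π : List Step) → DyckPrefix π → length π ≡ 2 * n → Ψ n π ≡ σ →
           height π ≡ + (2 * tiny n σ)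
theorem7 n σ _ π dyck len refl =
  height-counts π _ (proj₂ (correct (suc n) n π (dyck-from 0 π dyck) len ≤-refl))
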